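{- Let $\mathcal R$ be a TRS, and let $\to_{\mu_{\mathsf i}}$ and $\to_{\mu_{\mathsf t}}$ denote the $\mu_{\mathsf i}$-step relation and the $\mu_{\mathsf t}$-step relation of $\mathcal R$, respectively. Then for all terminating basic terms $t$ we have $\mathrm{dh}(t,\xrightarrow{i}_{\mathcal R})\le\mathrm{dh}(t,\to_{\mu_{\mathsf i}})$ and $\mathrm{dh}(t,\to_{\mathcal R})\le\mathrm{dh}(t,\to_{\mu_{\mathsf t}})$.
   Context: $\mathcal R$ is a TRS (finite set of rules $l\to r$, $l$ not a variable, $\mathrm{Var}(r)\subseteq\mathrm{Var}(l)$) over a finite signature; $\to_{\mathcal R}$ is its rewrite relation, $\mathrm{NF}(\mathcal R)$ its normal forms; innermost rewriting $s\xrightarrow{i}_{\mathcal R}t$ iff $s=C[l\sigma]$, $t=C[r\sigma]$ with all proper subterms of $l\sigma$ in $\mathrm{NF}(\mathcal R)$. Defined symbols: roots of left-hand sides; constructors: the rest; basic term: $f(t_1,\dots,t_n)$ with $f$ defined and all $t_i$ built from constructors and variables. $\mathrm{dh}(s,\to)=\max\{n\mid\exists t.\ s\to^n t\}$. A replacement map $\mu$ assigns to each $n$-ary $f$ a set $\mu(f)\subseteq\{1,\dots,n\}$ (identified with the set of pairs $(f,i)$, $i\in\mu(f)$). $\mathrm{Pos}_\mu(x)=\{\epsilon\}$ for variables, $\mathrm{Pos}_\mu(f(t_1,\dots,t_n))=\{\epsilon\}\cup\{ip\mid i\in\mu(f), p\in\mathrm{Pos}_\mu(t_i)\}$, $\mathrm{NPos}_\mu(t)=\mathrm{Pos}(t)\setminus\mathrm{Pos}_\mu(t)$.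 A $\mu$-step $s\to_\mu t$ is a step $s\to_{\mathcal R}t$ at a position in $\mathrm{Pos}_\mu(s)$. $\mathrm{CAP}^s_\mu(t)$: equals $t$ if $t=s|_p$ for some $p\in\mathrm{NPos}_\mu(s)$; otherwise if $t=f(t_1,\dots,t_n)$ and $u=f(\mathrm{CAP}^s_\mu(t_1),\dots,\mathrm{CAP}^s_\mu(t_n))$ unifies with no (renamed apart) left-hand side of $\mathcal R$, it equals $u$; otherwise it is a fresh variable. $\Upsilon(\mu)=\{(f,i)\mid l\to r\in\mathcal R,\ f(r_1,\dots,r_n)\text{ a subterm of }r,\ \mathrm{CAP}^l_\mu(r_i)\neq r_i\}$. $\mu_{\mathsf i}=\Upsilon(\varnothing)$ (innermost usable replacement map); $\mu_{\mathsf t}$ is the least fixed point of the monotone operator $\Upsilon$ (usable replacement map). -}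

module Defs where

open import Data.Nat using (ℕ; zero; suc; _≤_)
open import Data.Fin using (Fin; toℕ)
open import Data.Vec using (Vec; []; _∷_; lookup; _[_]≔_)
open import Data.List using (List; []; _∷_; _++_; [_])
open import Data.List.Membership.Propositional using (_∈_)
open import Data.Product using (Σ; ∃; ∃-syntax; _×_; _,_)
open import Data.Sum using (_⊎_; inj₁; inj₂)
open import Data.Empty using (⊥)
open import Data.Unit using (⊤)
open import Relation.Nullary using (¬_)
open import Relation.Binary.PropositionalEquality using (_≡_; _≢_)
open import Function.Bundles using (_↔_)
open import Induction.WellFounded using (Acc)

record Signature : Set₁ where
  field
    Fun    : Set
    arity  : Fun → ℕ
    finite : ∃[ k ] (Fun ↔ Fin k)

module _ (Sig : Signature) where
  open Signature Sig

  data Term (V : Set) : Set where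
    var : V → Term V
    fun : (f : Fun) → Vec (Term V) (arity f) → Term V

  mutual
    _⟨_⟩ : {V W : Set} → Term V → (V → Term W) → Term W
    var x    ⟨ σ ⟩ = σ x
    fun f ts ⟨ σ ⟩ = fun f (substs ts σ)

    substs : {V W : Set} {n : ℕ} → Vec (Term V) n → (V → Term W) → Vec (Term W) n
    substs []       σ = []
    substs (t ∷ ts) σ = (t ⟨ σ ⟩) ∷ substs ts σ

  -- Positions: sequences of argument indices (toℕ of the Fin index)
  Pos : Set
  Pos = List ℕ

  data SubtermAt {V : Set} : Term V → Pos → Term V → Set where
    here  : ∀ {t} → SubtermAt t [] t
    there : ∀ {f ts p u} (i : Fin (arity f)) →
            SubtermAt (lookup ts i) p u →
            SubtermAt (fun f ts) (toℕ i ∷ p) u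

  _∈Var_ : {V : Set} → V → Term V → Set
  x ∈Var t = ∃[ p ] SubtermAt t p (var x)

  -- Replacement maps: μ f i holds iff i ∈ μ(f)

  RMap : Set₁
  RMap = (f : Fun) → Fin (arity f) → Set

  ∅ : RMap
  ∅ f i = ⊥

  _⊆ᵣ_ : RMap → RMap → Set
  μ ⊆ᵣ ν = ∀ f i → μ f i → ν f i

  data PosMu (μ : RMap) {V : Set} : Term V → Pos → Set where
    root : ∀ {t} → PosMu μ t []
    arg  : ∀ {f ts p} (i : Fin (arity f)) → μ f i →
           PosMu μ (lookup ts i) p → PosMu μ (fun f ts) (toℕ i ∷ p)

  NPos : RMap → {V : Set} → Term V → Pos → Set
  NPos μ t p = (∃[ u ] SubtermAt t p u) × ¬ PosMu μ t p

  record Rule : Set where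
    field
      lhs : Term ℕ
      rhs : Term ℕ
      lhs-not-var : ∃[ f ] ∃[ ls ] (lhs ≡ fun f ls)
      var-cond    : ∀ x → x ∈Var rhs → x ∈Var lhs
  open Rule public

  TRS : Set
  TRS = List Rule

  module _ (R : TRS) where

    Defined : Fun → Set
    Defined f = ∃[ ρ ] (ρ ∈ R × ∃[ ls ] (lhs ρ ≡ fun f ls))

    Constructor : Fun → Set
    Constructor f = ¬ Defined f

    data ConstructorTerm : Term ℕ → Set where
      var : ∀ x → ConstructorTerm (var x)
      fun : ∀ {f ts} → Constructor f →
            (∀ i → ConstructorTerm (lookup ts i)) → ConstructorTerm (fun f ts)

    Basic : Term ℕ → Set
    Basic t = ∃[ f ] ∃[ ts ] (t ≡ fun f ts × Defined f ×
                               (∀ i → ConstructorTerm (lookup ts i)))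

    data StepAtWith (Cond : Rule → (ℕ → Term ℕ) → Set)
         : Term ℕ → Pos → Term ℕ → Set where
      root : ∀ {ρ} → ρ ∈ R → (σ : ℕ → Term ℕ) → Cond ρ σ →
             StepAtWith Cond (lhs ρ ⟨ σ ⟩) [] (rhs ρ ⟨ σ ⟩)
      inside : ∀ {f ts p u} (i : Fin (arity f)) →
               StepAtWith Cond (lookup ts i) p u →
               StepAtWith Cond (fun f ts) (toℕ i ∷ p) (fun f (ts [ i ]≔ u))

    NoCond : Rule → (ℕ → Term ℕ) → Set
    NoCond ρ σ = ⊤

    Step : Term ℕ → Term ℕ → Set
    Step s t = ∃[ p ] StepAtWith NoCond s p t

    NF : Term ℕ → Set
    NF s = ¬ (∃[ t ] Step s t)

    InnermostCond : Rule → (ℕ → Term ℕ) → Set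
    InnermostCond ρ σ = ∀ p u → p ≢ [] → SubtermAt (lhs ρ ⟨ σ ⟩) p u → NF u

    Innermost : Term ℕ → Term ℕ → Set
    Innermost s t = ∃[ p ] StepAtWith InnermostCond s p t

    MuStep : RMap → Term ℕ → Term ℕ → Set
    MuStep μ s t = ∃[ p ] (PosMu μ s p × StepAtWith NoCond s p t)

    -- Fresh variables are represented as inj₂ q, where q is the
    -- position (within the argument term) of the replaced subterm; these
    -- are pairwise distinct and distinct from all original variables.

    emb : Term ℕ → Term (ℕ ⊎ Pos)
    emb t = t ⟨ (λ x → var (inj₁ x)) ⟩

    -- u unifies with the (renamed apart) left-hand side l
    Unifiable : Term (ℕ ⊎ Pos) → Term ℕ → Set
    Unifiable u l = Σ (ℕ ⊎ Pos → Term (ℕ ⊎ Pos)) λ σ →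
                    Σ (ℕ → Term (ℕ ⊎ Pos)) λ τ → (u ⟨ σ ⟩) ≡ (l ⟨ τ ⟩)

    UnifiesSomeLhs : Term (ℕ ⊎ Pos) → Set
    UnifiesSomeLhs u = ∃[ ρ ] (ρ ∈ R × Unifiable u (lhs ρ))

    Frozen : RMap → Term ℕ → Term ℕ → Set
    Frozen μ s t = ∃[ p ] (NPos μ s p × SubtermAt s p t)

    -- Cap μ s q t c  :  c = CAP^s_μ(t), t being at position q of the
    -- argument term that CAP was originally applied to
    data Cap (μ : RMap) (s : Term ℕ) : Pos → Term ℕ → Term (ℕ ⊎ Pos) → Set where
      frozen : ∀ {q t} → Frozen μ s t → Cap μ s q t (emb t)
      keep   : ∀ {q f ts} {us : Vec (Term (ℕ ⊎ Pos)) (arity f)} →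
               ¬ Frozen μ s (fun f ts) →
               (∀ i → Cap μ s (q ++ [ toℕ i ]) (lookup ts i) (lookup us i)) →
               ¬ UnifiesSomeLhs (fun f us) →
               Cap μ s q (fun f ts) (fun f us)
      capFun : ∀ {q f ts} {us : Vec (Term (ℕ ⊎ Pos)) (arity f)} →
               ¬ Frozen μ s (fun f ts) →
               (∀ i → Cap μ s (q ++ [ toℕ i ]) (lookup ts i) (lookup us i)) →
               UnifiesSomeLhs (fun f us) →
               Cap μ s q (fun f ts) (var (inj₂ q))
      capVar : ∀ {q x} → ¬ Frozen μ s (var x) →
               Cap μ s q (var x) (var (inj₂ q))

    Υ : RMap → RMap
    Υ μ f i = ∃[ ρ ] (ρ ∈ R × ∃[ p ] ∃[ rs ] (SubtermAt (rhs ρ) p (fun f rs) ×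
                ∃[ c ] (Cap μ (lhs ρ) [] (lookup rs i) c × c ≢ emb (lookup rs i))))

    μᵢ : RMap
    μᵢ = Υ ∅

    IsLeastFixedPoint : RMap → Set₁
    IsLeastFixedPoint μ = (Υ μ ⊆ᵣ μ) × (μ ⊆ᵣ Υ μ) ×
                          (∀ ν → Υ ν ⊆ᵣ ν → ν ⊆ᵣ Υ ν → μ ⊆ᵣ ν)

  data Iter (_⇒_ : Term ℕ → Term ℕ → Set) : ℕ → Term ℕ → Term ℕ → Set where
    done : ∀ {s} → Iter _⇒_ zero s s
    step : ∀ {n s t u} → s ⇒ t → Iter _⇒_ n t u → Iter _⇒_ (suc n) s u

  IsDH : (Term ℕ → Term ℕ → Set) → Term ℕ → ℕ → Set
  IsDH _⇒_ s n = (∃[ t ] Iter _⇒_ n s t) × (∀ m t → Iter _⇒_ m s t → m ≤ n)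

  SN : (Term ℕ → Term ℕ → Set) → Term ℕ → Set
  SN _⇒_ s = Acc (λ t u → u ⇒ t) s

module Submission where

-- Call s μ-tame (NFOutside μ s) if every subterm of s at a position outside
-- Pos_μ(s) is a normal form.  A basic term is tame for every μ, since its proper
-- subterms are constructor terms, and every redex of a tame term lies at a
-- μ-position.  So an R-derivation of tame terms is a μ-derivation, and it remains
-- to see that steps preserve tameness.  After a root step lσ → rσ a frozen
-- subterm lies either in some σ(x), which is tame because lσ is, or below an
-- argument i of a subterm f(r₁,…,rₙ) of r with (f,i) ∉ μ.  If Υ(ν) ⊆ μ, the
-- latter forces CAP^l_ν(rᵢ) = rᵢ, and then rᵢσ is a normal form provided lσ has
-- normal forms at the positions in NPos_ν(l): along the cap, frozen subterms are
-- normal by assumption and kept ones are no redexes, their caps unifying with no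
-- lhs.  Innermost steps provide this for ν = ∅ and μ = μᵢ = Υ(∅); arbitrary steps
-- provide it for ν = μ = μₜ by tameness of lσ, using only Υ(μₜ) ⊆ μₜ.
-- Constructively each step is a μ-step only up to double negation, which
-- suffices since ≤ on ℕ is decidable.

open import Defs
open import Level using (0ℓ)
open import Data.Nat using (ℕ; _≤_; _≤?_)
open import Data.Product using (∃-syntax; _×_; _,_; proj₂)
open import Data.Sum using (_⊎_; inj₁; inj₂)
open import Data.Empty using (⊥)
open import Data.Unit using (tt)
open import Data.Fin using (Fin; toℕ; zero; suc; _≟_)
open import Data.Fin.Properties using (toℕ-injective)
open import Data.Vec using (Vec; []; _∷_; lookup; _[_]≔_)
open import Data.Vec.Properties using (lookup∘update; lookup∘update′)
open import Data.List using ([]; _∷_; _++_; [_])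
open import Data.List.Membership.Propositional using (_∈_)
open import Effect.Monad using (RawMonad)
open import Relation.Nullary using (¬_; yes; no)
open import Relation.Nullary.Decidable using (decidable-stable; ¬¬-excluded-middle)
open import Relation.Nullary.Negation using (¬¬-Monad; ¬¬-map)
open import Relation.Binary.PropositionalEquality
  using (_≡_; refl; sym; cong; cong₂; subst; module ≡-Reasoning)
open import Function using (_∘_)

open RawMonad (¬¬-Monad {0ℓ})

module _ (Sig : Signature) where
  open Signature Sig

  _⟪_⟫ : {V W : Set} → Term Sig V → (V → Term Sig W) → Term Sig W
  _⟪_⟫ = _⟨_⟩ Sig

  lookup-substs : ∀ {V W n} (ts : Vec (Term Sig V) n) (σ : V → Term Sig W) (i : Fin n) →
                  lookup (substs Sig ts σ) i ≡ lookup ts i ⟪ σ ⟫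
  lookup-substs (t ∷ ts) σ zero    = refl
  lookup-substs (t ∷ ts) σ (suc i) = lookup-substs ts σ i

  mutual
    ⟪⟫-∘ : ∀ {U V W} (t : Term Sig U) (σ : U → Term Sig V) (τ : V → Term Sig W) →
           t ⟪ σ ⟫ ⟪ τ ⟫ ≡ t ⟪ (λ x → σ x ⟪ τ ⟫) ⟫
    ⟪⟫-∘ (var x)    σ τ = refl
    ⟪⟫-∘ (fun f ts) σ τ = cong (fun f) (substs-∘ ts σ τ)

    substs-∘ : ∀ {U V W n} (ts : Vec (Term Sig U) n) (σ : U → Term Sig V) (τ : V → Term Sig W) →
               substs Sig (substs Sig ts σ) τ ≡ substs Sig ts (λ x → σ x ⟪ τ ⟫)
    substs-∘ []       σ τ = refl
    substs-∘ (t ∷ ts) σ τ = cong₂ _∷_ (⟪⟫-∘ t σ τ) (substs-∘ ts σ τ)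

  SubtermAt-⟪⟫ : ∀ {V W} {t : Term Sig V} {p u} (σ : V → Term Sig W) →
                 SubtermAt Sig t p u → SubtermAt Sig (t ⟪ σ ⟫) p (u ⟪ σ ⟫)
  SubtermAt-⟪⟫ σ here = here
  SubtermAt-⟪⟫ {p = _ ∷ p} {u} σ (there {ts = ts} i sb) =
    there i (subst (λ s → SubtermAt Sig s p (u ⟪ σ ⟫)) (sym (lookup-substs ts σ i))
                   (SubtermAt-⟪⟫ σ sb))

  SubtermAt-++ : ∀ {V} {s w v : Term Sig V} {p q} →
                 SubtermAt Sig s p w → SubtermAt Sig w q v → SubtermAt Sig s (p ++ q) v
  SubtermAt-++ here         sb′ = sb′
  SubtermAt-++ (there i sb) sb′ = there i (SubtermAt-++ sb sb′)

  PosMu-arg⁻¹ : ∀ {μ V f} {ts : Vec (Term Sig V) (arity f)} {i p} →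
                PosMu Sig μ (fun f ts) (toℕ i ∷ p) → μ f i × PosMu Sig μ (lookup ts i) p
  PosMu-arg⁻¹ {μ} {f = f} {ts} {i} {p} pm = invert pm refl
    where
      invert : ∀ {k} → PosMu Sig μ (fun f ts) (k ∷ p) → k ≡ toℕ i →
               μ f i × PosMu Sig μ (lookup ts i) p
      invert (arg j m pm′) k≡i with toℕ-injective k≡i
      ... | refl = m , pm′

  PosMu-⟪⟫⁻¹ : ∀ {μ V W} {l : Term Sig V} {p u} (σ : V → Term Sig W) →
               SubtermAt Sig l p u → PosMu Sig μ (l ⟪ σ ⟫) p → PosMu Sig μ l p
  PosMu-⟪⟫⁻¹ σ here _ = root
  PosMu-⟪⟫⁻¹ {μ} σ (there {ts = ts} {p = p} i sb) pm =
    let m , pmᵢ = PosMu-arg⁻¹ pm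
    in arg i m (PosMu-⟪⟫⁻¹ σ sb (subst (λ s → PosMu Sig μ s p) (lookup-substs ts σ i) pmᵢ))

  PosMu-⟪⟫-suffix : ∀ {μ V W} {l u : Term Sig V} {p q} (σ : V → Term Sig W) →
                    SubtermAt Sig l p u → PosMu Sig μ (l ⟪ σ ⟫) (p ++ q) → PosMu Sig μ (u ⟪ σ ⟫) q
  PosMu-⟪⟫-suffix σ here pm = pm
  PosMu-⟪⟫-suffix {μ} {q = q} σ (there {ts = ts} {p = p} i sb) pm =
    PosMu-⟪⟫-suffix σ sb
      (subst (λ s → PosMu Sig μ s (p ++ q)) (lookup-substs ts σ i) (proj₂ (PosMu-arg⁻¹ pm)))

  IsDH-≤ : ∀ {_⇒_ _⇛_ : Term Sig ℕ → Term Sig ℕ → Set} {s} →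
           (∀ {k u} → Iter Sig _⇒_ k s u → ¬ ¬ Iter Sig _⇛_ k s u) →
           ∀ n m → IsDH Sig _⇒_ s n → IsDH Sig _⇛_ s m → n ≤ m
  IsDH-≤ simulate n m ((u , d) , _) (_ , maximal) =
    decidable-stable (n ≤? m) (¬¬-map (maximal n u) (simulate d))

  module _ (R : TRS Sig) where

    StepWith : (Rule Sig → (ℕ → Term Sig ℕ) → Set) → Term Sig ℕ → Term Sig ℕ → Set
    StepWith C s t = ∃[ p ] StepAtWith Sig R C s p t

    SubtermAt-reducible : ∀ {s p w} → SubtermAt Sig s p w →
                          ∃[ w′ ] Step Sig R w w′ → ∃[ s′ ] Step Sig R s s′
    SubtermAt-reducible here         red = red
    SubtermAt-reducible (there i sb) red =
      let _ , q , st = SubtermAt-reducible sb red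
      in _ , toℕ i ∷ q , inside i st

    StepAtWith-redex : ∀ {C s p s′} → StepAtWith Sig R C s p s′ →
                       ∃[ w ] (SubtermAt Sig s p w × ∃[ w′ ] Step Sig R w w′)
    StepAtWith-redex (root ρ∈R σ _) = _ , here , _ , [] , root ρ∈R σ tt
    StepAtWith-redex (inside i st)  =
      let w , sb , red = StepAtWith-redex st
      in w , there i sb , red

    StepAtWith-NoCond : ∀ {C s p s′} → StepAtWith Sig R C s p s′ →
                        StepAtWith Sig R (NoCond Sig R) s p s′
    StepAtWith-NoCond (root ρ∈R σ _) = root ρ∈R σ tt
    StepAtWith-NoCond (inside i st)  = inside i (StepAtWith-NoCond st)

    lhs-⟪⟫-not-ConstructorTerm : ∀ {ρ} → ρ ∈ R → (σ : ℕ → Term Sig ℕ) →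
                                 ¬ ConstructorTerm Sig R (lhs ρ ⟪ σ ⟫)
    lhs-⟪⟫-not-ConstructorTerm {ρ} ρ∈R σ ct with lhs-not-var ρ
    ... | f , ls , l≡ = rootDefined (subst (λ l → ConstructorTerm Sig R (l ⟪ σ ⟫)) l≡ ct)
      where
        rootDefined : ¬ ConstructorTerm Sig R (fun f (substs Sig ls σ))
        rootDefined (fun constructor-f _) = constructor-f (ρ , ρ∈R , ls , l≡)

    ConstructorTerm-NF : ∀ {u} → ConstructorTerm Sig R u → NF Sig R u
    ConstructorTerm-NF ct (_ , _ , st) = irreducible ct st
      where
        irreducible : ∀ {u p w} → ConstructorTerm Sig R u →
                      ¬ StepAtWith Sig R (NoCond Sig R) u p w
        irreducible ct           (root ρ∈R σ _) = lhs-⟪⟫-not-ConstructorTerm ρ∈R σ ct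
        irreducible (fun _ args) (inside i st)  = irreducible (args i) st

    ConstructorTerm-SubtermAt : ∀ {u p v} → ConstructorTerm Sig R u →
                                SubtermAt Sig u p v → ConstructorTerm Sig R v
    ConstructorTerm-SubtermAt ct           here         = ct
    ConstructorTerm-SubtermAt (fun _ args) (there i sb) = ConstructorTerm-SubtermAt (args i) sb

    NFOutside : RMap Sig → Term Sig ℕ → Set
    NFOutside μ s = ∀ p u → ¬ PosMu Sig μ s p → SubtermAt Sig s p u → NF Sig R u

    Basic⇒NFOutside : ∀ {μ t} → Basic Sig R t → NFOutside μ t
    Basic⇒NFOutside _                         _ _ ¬root here         _ = ¬root root
    Basic⇒NFOutside (_ , _ , refl , _ , args) _ _ _     (there i sb) =
      ConstructorTerm-NF (ConstructorTerm-SubtermAt (args i) sb)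

    NFOutside-arg : ∀ {μ f ts} {i : Fin (arity f)} →
                    NFOutside μ (fun f ts) → NFOutside μ (lookup ts i)
    NFOutside-arg {i = i} tame p u ¬pm sb =
      tame (toℕ i ∷ p) u (λ pm → ¬pm (proj₂ (PosMu-arg⁻¹ pm))) (there i sb)

    NFOutside-⟪⟫-var : ∀ {μ} (l : Term Sig ℕ) (σ : ℕ → Term Sig ℕ) →
                       NFOutside μ (l ⟪ σ ⟫) → ∀ x → _∈Var_ Sig x l → NFOutside μ (σ x)
    NFOutside-⟪⟫-var l σ tame x (p , sb) q w ¬pm sb′ =
      tame (p ++ q) w (λ pm → ¬pm (PosMu-⟪⟫-suffix σ sb pm)) (SubtermAt-++ (SubtermAt-⟪⟫ σ sb) sb′)

    NFOutside⇒redex-in-PosMu : ∀ {μ C s p s′} → NFOutside μ s →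
                               StepAtWith Sig R C s p s′ → ¬ ¬ PosMu Sig μ s p
    NFOutside⇒redex-in-PosMu tame st ¬pm =
      let w , sb , red = StepAtWith-redex st
      in tame _ w ¬pm sb red

    RootPreserves : RMap Sig → (Rule Sig → (ℕ → Term Sig ℕ) → Set) → Set
    RootPreserves μ C = ∀ {ρ} → ρ ∈ R → (σ : ℕ → Term Sig ℕ) → C ρ σ →
                        NFOutside μ (lhs ρ ⟪ σ ⟫) → NFOutside μ (rhs ρ ⟪ σ ⟫)

    StepAtWith-NFOutside : ∀ {μ C s p s′} → RootPreserves μ C → NFOutside μ s →
                           StepAtWith Sig R C s p s′ → PosMu Sig μ s p → NFOutside μ s′
    StepAtWith-NFOutside preserves tame (root ρ∈R σ c) _ = preserves ρ∈R σ c tame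
    StepAtWith-NFOutside preserves tame (inside i st) _ _ _ ¬root here _ = ¬root root
    StepAtWith-NFOutside {μ} preserves tame (inside {ts = ts} {u = u} i st) pm
                         _ v ¬pm (there {p = q} j sb) with PosMu-arg⁻¹ pm | j ≟ i
    ... | m , pmᵢ | yes refl =
      StepAtWith-NFOutside preserves (NFOutside-arg tame) st pmᵢ q v
        (λ pm′ → ¬pm (arg i m (subst (λ s → PosMu Sig μ s q) (sym (lookup∘update i ts u)) pm′)))
        (subst (λ s → SubtermAt Sig s q v) (lookup∘update i ts u) sb)
    ... | _ | no j≢i =
      tame (toℕ j ∷ q) v
        (λ pm′ → let m , pmⱼ = PosMu-arg⁻¹ pm′
                 in ¬pm (arg j m (subst (λ s → PosMu Sig μ s q) (sym unchanged) pmⱼ)))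
        (there j (subst (λ s → SubtermAt Sig s q v) unchanged sb))
      where
        unchanged : lookup (ts [ i ]≔ u) j ≡ lookup ts j
        unchanged = lookup∘update′ j≢i ts u

    μ-derivation : ∀ {μ C s} → RootPreserves μ C → NFOutside μ s →
                   ∀ {n u} → Iter Sig (StepWith C) n s u → ¬ ¬ Iter Sig (MuStep Sig R μ) n s u
    μ-derivation preserves tame done = return done
    μ-derivation preserves tame (step (p , st) d) = do
      pm ← NFOutside⇒redex-in-PosMu tame st
      d′ ← μ-derivation preserves (StepAtWith-NFOutside preserves tame st pm) d
      return (step (p , pm , StepAtWith-NoCond st) d′)

    module _ (ν : RMap Sig) (l : Term Sig ℕ) where
      mutual
        Cap-exists : ∀ q t → ¬ ¬ (∃[ c ] Cap Sig R ν l q t c)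
        Cap-exists q (var x) = do
          no ¬fr ← ¬¬-excluded-middle {A = Frozen Sig R ν l (var x)} where yes fr → return (_ , frozen fr)
          return (_ , capVar ¬fr)
        Cap-exists q (fun f ts) = do
          no ¬fr ← ¬¬-excluded-middle {A = Frozen Sig R ν l (fun f ts)} where yes fr → return (_ , frozen fr)
          us , caps ← Caps-exist ts (λ i → q ++ [ toℕ i ])
          yes unif ← ¬¬-excluded-middle {A = UnifiesSomeLhs Sig R (fun f us)} where no ¬unif → return (_ , keep ¬fr caps ¬unif)
          return (_ , capFun ¬fr caps unif)

        Caps-exist : ∀ {n} (ts : Vec (Term Sig ℕ) n) (q : Fin n → Pos Sig) →
                     ¬ ¬ (∃[ us ] (∀ i → Cap Sig R ν l (q i) (lookup ts i) (lookup us i)))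
        Caps-exist []       q = return ([] , λ ())
        Caps-exist (t ∷ ts) q = do
          c , cap ← Cap-exists (q zero) t
          us , caps ← Caps-exist ts (q ∘ suc)
          return (c ∷ us , λ { zero → cap ; (suc i) → caps i })

    NPosNF : RMap Sig → Term Sig ℕ → (ℕ → Term Sig ℕ) → Set
    NPosNF ν l σ = ∀ p u → NPos Sig ν l p → SubtermAt Sig l p u → NF Sig R (u ⟪ σ ⟫)

    Cap-emb⇒NF : ∀ {ν l σ q t c} → NPosNF ν l σ → Cap Sig R ν l q t c →
                 c ≡ emb Sig R t → NF Sig R (t ⟪ σ ⟫)
    Cap-emb⇒NF frozenNF (frozen (p , np , sb)) _ = frozenNF p _ np sb
    Cap-emb⇒NF {σ = σ} frozenNF (keep {f = f} {ts} _ caps ¬unif) refl (_ , _ , st) =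
      irreducible st refl
      where
        open ≡-Reasoning

        -- The cap is emb (fun f ts), which has no fresh variables, so σ̂ may send them anywhere.
        σ̂ : ℕ ⊎ Pos Sig → Term Sig (ℕ ⊎ Pos Sig)
        σ̂ (inj₁ x) = emb Sig R (σ x)
        σ̂ (inj₂ _) = var (inj₂ [])

        unifier : ∀ {ρ} σ′ → lhs ρ ⟪ σ′ ⟫ ≡ fun f (substs Sig ts σ) →
                  emb Sig R (fun f ts) ⟪ σ̂ ⟫ ≡ lhs ρ ⟪ emb Sig R ∘ σ′ ⟫
        unifier {ρ} σ′ l≡ = begin
          emb Sig R (fun f ts) ⟪ σ̂ ⟫           ≡⟨ ⟪⟫-∘ (fun f ts) _ σ̂ ⟩
          fun f ts ⟪ emb Sig R ∘ σ ⟫           ≡⟨ sym (⟪⟫-∘ (fun f ts) σ _) ⟩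
          emb Sig R (fun f ts ⟪ σ ⟫)           ≡⟨ cong (emb Sig R) (sym l≡) ⟩
          emb Sig R (lhs ρ ⟪ σ′ ⟫)             ≡⟨ ⟪⟫-∘ (lhs ρ) σ′ _ ⟩
          lhs ρ ⟪ emb Sig R ∘ σ′ ⟫             ∎

        irreducible : ∀ {s p w} → StepAtWith Sig R (NoCond Sig R) s p w →
                      s ≡ fun f (substs Sig ts σ) → ⊥
        irreducible (root {ρ} ρ∈R σ′ _) l≡ = ¬unif (ρ , ρ∈R , σ̂ , emb Sig R ∘ σ′ , unifier {ρ} σ′ l≡)
        irreducible (inside i st) refl =
          Cap-emb⇒NF frozenNF (caps i) (lookup-substs ts (λ x → var (inj₁ x)) i)
            (_ , _ , subst (λ s → StepAtWith Sig R (NoCond Sig R) s _ _) (lookup-substs ts σ i) st)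
    Cap-emb⇒NF _ (capFun _ _ _) ()
    Cap-emb⇒NF _ (capVar _)     ()

    module _ (ν μ : RMap Sig) (Υν⊆μ : _⊆ᵣ_ Sig (Υ Sig R ν) μ)
             {ρ : Rule Sig} (ρ∈R : ρ ∈ R) (σ : ℕ → Term Sig ℕ) (frozenNF : NPosNF ν (lhs ρ) σ)
             (varsNF : ∀ x → _∈Var_ Sig x (lhs ρ) → NFOutside μ (σ x)) where
      mutual
        rhs-subterm-NFOutside : ∀ r → ∃[ p ] SubtermAt Sig (rhs ρ) p r → NFOutside μ (r ⟪ σ ⟫)
        rhs-subterm-NFOutside (var x) occ = varsNF x (var-cond ρ x occ)
        rhs-subterm-NFOutside (fun f rs) _ _ _ ¬root here _ = ¬root root
        rhs-subterm-NFOutside (fun f rs) (p , sb) _ v ¬pm (there {p = q} j sbⱼ) red =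
          ¬¬-excluded-middle {A = μ f j} λ where
            (yes m) → args-NFOutside rs (λ i → p ++ [ toℕ i ] , SubtermAt-++ sb (there i here)) j q v
                        (λ pm → ¬pm (arg j m (subst (λ s → PosMu Sig μ s q) (sym lookup-rsσ) pm)))
                        sbⱼ′ red
            (no ¬m) → Cap-exists ν (lhs ρ) [] (lookup rs j) λ (c , cap) →
                        ¬m (Υν⊆μ f j (ρ , ρ∈R , p , rs , sb , c , cap ,
                              λ c≡ → Cap-emb⇒NF frozenNF cap c≡ (SubtermAt-reducible sbⱼ′ red)))
          where
            lookup-rsσ : lookup (substs Sig rs σ) j ≡ lookup rs j ⟪ σ ⟫
            lookup-rsσ = lookup-substs rs σ j
            sbⱼ′ : SubtermAt Sig (lookup rs j ⟪ σ ⟫) q v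
            sbⱼ′ = subst (λ s → SubtermAt Sig s q v) lookup-rsσ sbⱼ

        args-NFOutside : ∀ {n} (rs : Vec (Term Sig ℕ) n) →
                         (∀ i → ∃[ p ] SubtermAt Sig (rhs ρ) p (lookup rs i)) →
                         ∀ i → NFOutside μ (lookup rs i ⟪ σ ⟫)
        args-NFOutside (r ∷ rs) occ zero    = rhs-subterm-NFOutside r (occ zero)
        args-NFOutside (r ∷ rs) occ (suc i) = args-NFOutside rs (occ ∘ suc) i

      rhs-NFOutside : NFOutside μ (rhs ρ ⟪ σ ⟫)
      rhs-NFOutside = rhs-subterm-NFOutside (rhs ρ) ([] , here)

    NFOutside⇒NPosNF : ∀ {μ} (l : Term Sig ℕ) (σ : ℕ → Term Sig ℕ) →
                       NFOutside μ (l ⟪ σ ⟫) → NPosNF μ l σ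
    NFOutside⇒NPosNF l σ tame p u (_ , ¬pm) sb =
      tame p (u ⟪ σ ⟫) (λ pm → ¬pm (PosMu-⟪⟫⁻¹ σ sb pm)) (SubtermAt-⟪⟫ σ sb)

    InnermostCond⇒NPosNF-∅ : ∀ {ρ} (σ : ℕ → Term Sig ℕ) →
                             InnermostCond Sig R ρ σ → NPosNF (∅ Sig) (lhs ρ) σ
    InnermostCond⇒NPosNF-∅ σ inn p u (_ , ¬pm) sb =
      inn p (u ⟪ σ ⟫) (λ { refl → ¬pm root }) (SubtermAt-⟪⟫ σ sb)

    μᵢ-RootPreserves-innermost : RootPreserves (μᵢ Sig R) (InnermostCond Sig R)
    μᵢ-RootPreserves-innermost {ρ} ρ∈R σ inn tame =
      rhs-NFOutside (∅ Sig) (μᵢ Sig R) (λ _ _ υ → υ) ρ∈R σ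
        (InnermostCond⇒NPosNF-∅ {ρ} σ inn) (NFOutside-⟪⟫-var (lhs ρ) σ tame)

    prefixed-RootPreserves : ∀ {μ} → _⊆ᵣ_ Sig (Υ Sig R μ) μ → RootPreserves μ (NoCond Sig R)
    prefixed-RootPreserves {μ} Υμ⊆μ {ρ} ρ∈R σ _ tame =
      rhs-NFOutside μ μ Υμ⊆μ ρ∈R σ
        (NFOutside⇒NPosNF (lhs ρ) σ tame) (NFOutside-⟪⟫-var (lhs ρ) σ tame)

corollary18 : (Sig : Signature) (R : TRS Sig) (μₜ : RMap Sig) →
              IsLeastFixedPoint Sig R μₜ →
              (t : Term Sig ℕ) → Basic Sig R t → SN Sig (Step Sig R) t →
              ((n m : ℕ) → IsDH Sig (Innermost Sig R) t n →
                 IsDH Sig (MuStep Sig R (μᵢ Sig R)) t m → n ≤ m)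
              × ((n m : ℕ) → IsDH Sig (Step Sig R) t n →
                 IsDH Sig (MuStep Sig R μₜ) t m → n ≤ m)
corollary18 Sig R μₜ (Υμₜ⊆μₜ , _ , _) _ basic _ =
  IsDH-≤ Sig (μ-derivation Sig R (μᵢ-RootPreserves-innermost Sig R) (Basic⇒NFOutside Sig R basic)) ,
  IsDH-≤ Sig (μ-derivation Sig R (prefixed-RootPreserves Sig R Υμₜ⊆μₜ) (Basic⇒NFOutside Sig R basic))
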